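{- Let $D$ be a digraph such that every proper induced subdigraph of $D$ satisfies the $\alpha$-property, let $S$ be a maximum stable set of $D$, and let $v_1v_2$ be an arc of $D$. Then (i) if $v_1\notin S$ and $N^-(v_2)=\{v_1\}$, then $D$ admits an $S$-path partition; (ii) if $v_2\notin S$ and $N^+(v_1)=\{v_2\}$, then $D$ admits an $S$-path partition.
   Context: Digraphs are finite, loopless, without multiple arcs (digons allowed). $N^-(v)$ and $N^+(v)$ denote the sets of in- and out-neighbours of $v$. A stable set is a set of pairwise non-adjacent vertices. A path partition is a collection of vertex-disjoint (directed) paths covering $V(D)$. For a stable set $S$, an $S$-path partition is a path partition in which each path contains exactly one vertex of $S$. A digraph satisfies the $\alpha$-property if for every maximum stable set $S$ it admits an $S$-path partition. -}

module Defs where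

open import Data.Nat using (ℕ; _≤_)
open import Data.Bool using (Bool; true; false)
open import Data.Fin using (Fin)
open import Data.Fin.Subset using (Subset; _∈_; _∉_; _⊆_; ∣_∣)
open import Data.Fin.Subset.Properties using (_∈?_)
open import Data.List using (List; []; _∷_; concat; length; filter)
open import Data.List.Relation.Unary.All using (All)
open import Data.List.Relation.Unary.Unique.Propositional using (Unique)
import Data.List.Membership.Propositional as LM
open import Data.Product using (Σ; ∃; _×_)
open import Function.Bundles using (_⇔_)
open import Relation.Binary.PropositionalEquality using (_≡_)

-- A finite digraph on vertex set Fin n. Arcs are given by a Boolean
-- adjacency relation (so there are no multiple arcs); digons are allowed;
-- loops are excluded.
record Digraph (n : ℕ) : Set where
  field
    adj      : Fin n → Fin n → Bool
    loopless : ∀ v → adj v v ≡ false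
open Digraph public

module _ {n : ℕ} (D : Digraph n) where

  Arc : Fin n → Fin n → Set
  Arc u v = adj D u v ≡ true

  NonAdj : Fin n → Fin n → Set
  NonAdj u v = adj D u v ≡ false × adj D v u ≡ false

  IsStableIn : Subset n → Subset n → Set
  IsStableIn X S = S ⊆ X × (∀ u v → u ∈ S → v ∈ S → NonAdj u v)

  IsMaxStableIn : Subset n → Subset n → Set
  IsMaxStableIn X S = IsStableIn X S × (∀ T → IsStableIn X T → ∣ T ∣ ≤ ∣ S ∣)

  data Chain : List (Fin n) → Set where
    chain-[] : Chain []
    chain-1  : ∀ v → Chain (v ∷ [])
    chain-∷  : ∀ u v {vs} → Arc u v → Chain (v ∷ vs) → Chain (u ∷ v ∷ vs)

  IsPath : List (Fin n) → Set
  IsPath p = (1 ≤ length p) × Unique p × Chain p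

  IsPathPartitionOf : Subset n → List (List (Fin n)) → Set
  IsPathPartitionOf X P =
    All IsPath P × Unique (concat P) × (∀ v → (v ∈ X) ⇔ (v LM.∈ concat P))

  countIn : Subset n → List (Fin n) → ℕ
  countIn S p = length (filter (_∈? S) p)

  IsSPathPartitionOf : Subset n → Subset n → List (List (Fin n)) → Set
  IsSPathPartitionOf X S P =
    IsPathPartitionOf X P × All (λ p → countIn S p ≡ 1) P

  AdmitsSPP : Subset n → Subset n → Set
  AdmitsSPP X S = ∃ λ P → IsSPathPartitionOf X S P

  AlphaPropertyIn : Subset n → Set
  AlphaPropertyIn X = ∀ S → IsMaxStableIn X S → AdmitsSPP X S

  Proper : Subset n → Set
  Proper X = ∃ λ v → v ∉ X

-- Delete the vertex v ∉ S (v₁ in (i), v₂ in (ii)). S remains a maximum stable set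
-- of the proper subdigraph D − v, which therefore has an S-path partition. In (i)
-- the only in-neighbour of v₂ is the deleted v₁, so v₂ starts its path and v₁ can
-- be put in front of it; in (ii) symmetrically v₁ ends its path and v₂ is appended.
-- Since v ∉ S, the new path still meets S exactly once.
module Submission where

open import Defs
open import Data.Nat using (ℕ; s≤s; z≤n; _≤_)
open import Data.Fin using (Fin; _≟_)
open import Data.Fin.Subset using (Subset; ⊤; _∈_; _∉_; ∁; ⁅_⁆)
open import Data.Fin.Subset.Properties
  using (_∈?_; ∈⊤; x∈⁅x⁆; x≢y⇒x∉⁅y⁆; x∈∁p⇒x∉p; x∉p⇒x∈∁p)
open import Data.List using (List; _∷_; _++_; _∷ʳ_; concat; length)
open import Data.List.Properties using (concat-++; filter-reject)
open import Data.List.Relation.Unary.All using (_∷_; lookup)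
open import Data.List.Relation.Unary.All.Properties using (¬Any⇒All¬)
open import Data.List.Relation.Unary.Any using (here; there)
open import Data.List.Relation.Unary.AllPairs using (_∷_)
open import Data.List.Relation.Unary.Unique.Propositional using (Unique)
open import Data.List.Membership.Propositional using () renaming (_∈_ to _∈ₗ_; _∉_ to _∉ₗ_)
open import Data.List.Membership.Propositional.Properties using (∈-∃++; ∈-++⁺ˡ; ∈-concat⁺′; ∈-concat⁻′)
open import Data.List.Relation.Binary.Permutation.Propositional
  using (_↭_; ↭-refl; ↭-sym; ↭⇒↭ₛ; module PermutationReasoning)
open import Data.List.Relation.Binary.Permutation.Propositional.Properties
  using (All-resp-↭; ∈-resp-↭; ↭-length; ++⁺ʳ; shift; shifts; ∷↭∷ʳ; filter-↭)
import Data.List.Relation.Binary.Permutation.Setoid.Properties as SetoidPermutation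
open import Data.Product using (_×_; _,_; ∃; ∃₂; proj₁; proj₂)
open import Data.Empty using (⊥-elim)
open import Function using (_∘_)
open import Function.Bundles using (_⇔_; mk⇔; Equivalence)
open import Relation.Binary.PropositionalEquality
  using (_≡_; _≢_; refl; sym; subst; cong; setoid; module ≡-Reasoning)
open import Relation.Nullary using (¬_; yes; no)

open Equivalence using (to; from)

Unique-resp-↭ : ∀ {A : Set} {xs ys : List A} → xs ↭ ys → Unique xs → Unique ys
Unique-resp-↭ {A} = SetoidPermutation.Unique-resp-↭ (setoid A) ∘ ↭⇒↭ₛ

module _ {n : ℕ} where

  x∉∁⁅x⁆ : (x : Fin n) → x ∉ ∁ ⁅ x ⁆
  x∉∁⁅x⁆ x x∈∁⁅x⁆ = x∈∁p⇒x∉p x∈∁⁅x⁆ (x∈⁅x⁆ x)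

  x≢y⇒x∈∁⁅y⁆ : {x y : Fin n} → x ≢ y → x ∈ ∁ ⁅ y ⁆
  x≢y⇒x∈∁⁅y⁆ = x∉p⇒x∈∁p ∘ x≢y⇒x∉⁅y⁆

module _ {n : ℕ} (D : Digraph n) where

  Arc⇒≢ : {u v : Fin n} → Arc D u v → u ≢ v
  Arc⇒≢ {u} arc refl with subst (_≡ _) arc (loopless D u)
  ... | ()

  noArcInto⇒head : ∀ {p v} → Chain D p → v ∈ₗ p → (∀ u → u ∈ₗ p → ¬ Arc D u v)
                 → ∃ λ xs → p ≡ v ∷ xs
  noArcInto⇒head _ (here refl) _ = _ , refl
  noArcInto⇒head (chain-∷ x y arc chain) (there v∈p) noArc
    with noArcInto⇒head chain v∈p (λ u → noArc u ∘ there)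
  ... | _ , refl = ⊥-elim (noArc x (here refl) arc)

  noArcOutOf⇒Chain-∷ʳ : ∀ {p v w} → Chain D p → v ∈ₗ p → (∀ u → u ∈ₗ p → ¬ Arc D v u)
                      → Arc D v w → Chain D (p ∷ʳ w)
  noArcOutOf⇒Chain-∷ʳ {w = w} (chain-1 x) (here refl) _ arc = chain-∷ x w arc (chain-1 w)
  noArcOutOf⇒Chain-∷ʳ (chain-∷ x y arcxy _) (here refl) noArc _ =
    ⊥-elim (noArc y (there (here refl)) arcxy)
  noArcOutOf⇒Chain-∷ʳ (chain-∷ x y arcxy chain) (there v∈p) noArc arc =
    chain-∷ x y arcxy (noArcOutOf⇒Chain-∷ʳ chain v∈p (λ u → noArc u ∘ there) arc)

  pathThrough : ∀ {v u P} → IsPathPartitionOf D (∁ ⁅ v ⁆) P → u ≢ v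
              → ∃₂ λ A B → ∃ λ p → P ≡ A ++ p ∷ B × u ∈ₗ p × v ∉ₗ p × Chain D p
  pathThrough {v} {u} {P} (paths , _ , cover) u≢v =
    let p , u∈p , p∈P = ∈-concat⁻′ P (to (cover u) (x≢y⇒x∈∁⁅y⁆ u≢v))
        A , B , P≡ApB = ∈-∃++ p∈P
    in  A , B , p , P≡ApB , u∈p
      , (λ v∈p → x∉∁⁅x⁆ v (from (cover v) (∈-concat⁺′ v∈p p∈P)))
      , proj₂ (proj₂ (lookup paths p∈P))

module _ {n : ℕ} (D : Digraph n) (S : Subset n) where

  countIn-resp-↭ : ∀ {xs ys} → xs ↭ ys → countIn D S xs ≡ countIn D S ys
  countIn-resp-↭ = ↭-length ∘ filter-↭ (_∈? S)

  countIn-∷-∉ : ∀ {v} p → v ∉ S → countIn D S (v ∷ p) ≡ countIn D S p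
  countIn-∷-∉ p v∉S = cong length (filter-reject (_∈? S) v∉S)

  IsMaxStableIn-∁⁅⁆ : ∀ {v} → v ∉ S → IsMaxStableIn D ⊤ S → IsMaxStableIn D (∁ ⁅ v ⁆) S
  IsMaxStableIn-∁⁅⁆ v∉S ((_ , stable) , maximum) =
      ((λ u∈S → x≢y⇒x∈∁⁅y⁆ λ { refl → v∉S u∈S }) , stable)
    , λ T T-stable → maximum T ((λ _ → ∈⊤) , proj₂ T-stable)

  concat-shift : ∀ (A : List (List (Fin n))) p B → p ++ concat (A ++ B) ↭ concat (A ++ p ∷ B)
  concat-shift A p B = begin
    p ++ concat (A ++ B)          ≡⟨ cong (p ++_) (concat-++ A B) ⟨
    p ++ concat A ++ concat B     ↭⟨ shifts p (concat A) ⟩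
    concat A ++ p ++ concat B     ≡⟨ concat-++ A (p ∷ B) ⟩
    concat (A ++ p ∷ B)           ∎
    where open PermutationReasoning

  insertVertex : ∀ {v A B p q} → v ∉ S → IsSPathPartitionOf D (∁ ⁅ v ⁆) S (A ++ p ∷ B)
               → Chain D q → q ↭ v ∷ p → AdmitsSPP D ⊤ S
  insertVertex {v} {A} {B} {p} {q} v∉S ((paths , unique , cover) , counts) q-chain q↭vp
    with All-resp-↭ (shift p A B) paths | All-resp-↭ (shift p A B) counts
  ... | (_ , p-unique , _) ∷ paths′ | p-count ∷ counts′ =
    q ∷ A ++ B , ((q-path ∷ paths′ , Unique-resp-↭ (↭-sym perm) vP-unique , cover′) , q-count ∷ counts′)
    where
    v∉P : v ∉ₗ concat (A ++ p ∷ B)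
    v∉P v∈P = x∉∁⁅x⁆ v (from (cover v) v∈P)

    vP-unique : Unique (v ∷ concat (A ++ p ∷ B))
    vP-unique = ¬Any⇒All¬ _ v∉P ∷ unique

    perm : q ++ concat (A ++ B) ↭ v ∷ concat (A ++ p ∷ B)
    perm = begin
      q ++ concat (A ++ B)          ↭⟨ ++⁺ʳ _ q↭vp ⟩
      v ∷ p ++ concat (A ++ B)      <⟨ concat-shift A p B ⟩
      v ∷ concat (A ++ p ∷ B)       ∎
      where open PermutationReasoning

    q-path : IsPath D q
    q-path = subst (1 ≤_) (sym (↭-length q↭vp)) (s≤s z≤n)
           , Unique-resp-↭ (↭-sym q↭vp) (¬Any⇒All¬ p (v∉P ∘ ∈-resp-↭ (concat-shift A p B) ∘ ∈-++⁺ˡ) ∷ p-unique)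
           , q-chain

    q-count : countIn D S q ≡ 1
    q-count = begin
      countIn D S q        ≡⟨ countIn-resp-↭ q↭vp ⟩
      countIn D S (v ∷ p)  ≡⟨ countIn-∷-∉ p v∉S ⟩
      countIn D S p        ≡⟨ p-count ⟩
      1                    ∎
      where open ≡-Reasoning

    cover′ : ∀ u → u ∈ ⊤ ⇔ u ∈ₗ concat (q ∷ A ++ B)
    cover′ u = mk⇔ (λ _ → ∈-resp-↭ (↭-sym perm) u∈vP) (λ _ → ∈⊤)
      where
      u∈vP : u ∈ₗ v ∷ concat (A ++ p ∷ B)
      u∈vP with u ≟ v
      ... | yes u≡v = here u≡v
      ... | no  u≢v = there (to (cover u) (x≢y⇒x∈∁⁅y⁆ u≢v))

  prependSource : ∀ {v₁ v₂} → v₁ ∉ S → Arc D v₁ v₂ → (∀ u → Arc D u v₂ → u ≡ v₁)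
                → AdmitsSPP D (∁ ⁅ v₁ ⁆) S → AdmitsSPP D ⊤ S
  prependSource {v₁} {v₂} v₁∉S arc onlyIn (P , spp)
    with pathThrough D (proj₁ spp) (Arc⇒≢ D arc ∘ sym)
  ... | A , B , p , refl , v₂∈p , v₁∉p , chain
    with noArcInto⇒head D chain v₂∈p (λ u u∈p arc′ → v₁∉p (subst (_∈ₗ p) (onlyIn u arc′) u∈p))
  ... | _ , refl = insertVertex v₁∉S spp (chain-∷ v₁ v₂ arc chain) ↭-refl

  appendSink : ∀ {v₁ v₂} → v₂ ∉ S → Arc D v₁ v₂ → (∀ w → Arc D v₁ w → w ≡ v₂)
             → AdmitsSPP D (∁ ⁅ v₂ ⁆) S → AdmitsSPP D ⊤ S
  appendSink {v₁} {v₂} v₂∉S arc onlyOut (P , spp)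
    with pathThrough D (proj₁ spp) (Arc⇒≢ D arc)
  ... | A , B , p , refl , v₁∈p , v₂∉p , chain =
    insertVertex v₂∉S spp
      (noArcOutOf⇒Chain-∷ʳ D chain v₁∈p (λ w w∈p arc′ → v₂∉p (subst (_∈ₗ p) (onlyOut w arc′) w∈p)) arc)
      (↭-sym (∷↭∷ʳ v₂ p))

lemma6 : (n : ℕ) (D : Digraph n)
    → (∀ X → Proper D X → AlphaPropertyIn D X)
    → (S : Subset n) → IsMaxStableIn D ⊤ S
    → (v₁ v₂ : Fin n) → Arc D v₁ v₂
    → ((v₁ ∉ S → (∀ u → Arc D u v₂ ⇔ (u ≡ v₁)) → AdmitsSPP D ⊤ S)
    × (v₂ ∉ S → (∀ w → Arc D v₁ w ⇔ (w ≡ v₂)) → AdmitsSPP D ⊤ S))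
lemma6 n D alpha S maxS v₁ v₂ arc =
    (λ v₁∉S inNbrs → prependSource D S v₁∉S arc (to ∘ inNbrs) (deleteVertex v₁∉S))
  , (λ v₂∉S outNbrs → appendSink D S v₂∉S arc (to ∘ outNbrs) (deleteVertex v₂∉S))
  where
  deleteVertex : ∀ {v} → v ∉ S → AdmitsSPP D (∁ ⁅ v ⁆) S
  deleteVertex {v} v∉S = alpha (∁ ⁅ v ⁆) (v , x∉∁⁅x⁆ v) S (IsMaxStableIn-∁⁅⁆ D S v∉S maxS)
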